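{- For r.e. theories $A$ and $B$, if $\mathsf{G1}$ holds for both $A$ and $B$, then $\mathsf{G1}$ holds for $A\oplus B$.
   Context: $\mathsf{G1}$ holds for an r.e. theory $T$ if every consistent r.e. theory interpreting $T$ is incomplete; equivalently $T$ is essentially undecidable (every consistent r.e. extension in the same language is undecidable). $A\oplus B$ is the theory in the disjoint union of the signatures of $A$ and $B$ plus a fresh $0$-ary predicate symbol $P$, axiomatized by all $P\to\varphi$ for $\varphi$ a sentence of $A$ (theorem of $A$) and all $\neg P\to\psi$ for $\psi$ a sentence of $B$. -}

module Defs where

open import Data.Nat using (ℕ; zero; suc)
open import Data.Fin using (Fin; zero; suc)
open import Data.Vec using (Vec; []; _∷_)
open import Data.List using (List; []; _∷_; map)
open import Data.List.Membership.Propositional using (_∈_)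
open import Data.List.Relation.Unary.All using (All)
open import Data.Bool using (Bool; true)
open import Data.Maybe using (Maybe; just; nothing)
import Data.Maybe as Maybe
open import Data.Product using (Σ; _×_; _,_; ∃-syntax)
open import Data.Sum using (_⊎_; inj₁; inj₂; [_,_])
import Data.Sum.Properties as SumP
open import Data.Unit using (⊤; tt)
import Data.Unit.Properties as UnitP
open import Relation.Nullary using (¬_)
open import Relation.Binary.Definitions using (DecidableEquality)
open import Relation.Binary.PropositionalEquality using (_≡_; refl; cong)

-- First-order signatures (effective: decidable equality and an
-- enumeration of the symbols, as needed for r.e. theories)

record Signature : Set₁ where
  field
    Fun Rel       : Set
    fun-arity     : Fun → ℕ
    rel-arity     : Rel → ℕ
    Fun-dec       : DecidableEquality Fun
    Rel-dec       : DecidableEquality Rel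
    Fun-enum      : ℕ → Maybe Fun
    Fun-enum-surj : ∀ f → ∃[ n ] Fun-enum n ≡ just f
    Rel-enum      : ℕ → Maybe Rel
    Rel-enum-surj : ∀ R → ∃[ n ] Rel-enum n ≡ just R

open Signature public

data Term (L : Signature) (n : ℕ) : Set where
  var : Fin n → Term L n
  fun : (f : Fun L) → Vec (Term L n) (fun-arity L f) → Term L n

infixr 5 _⇒_
infix 7 _≐_

data Formula (L : Signature) (n : ℕ) : Set where
  ⊥'  : Formula L n
  _⇒_ : Formula L n → Formula L n → Formula L n
  ∀'  : Formula L (suc n) → Formula L n
  rel : (R : Rel L) → Vec (Term L n) (rel-arity L R) → Formula L n
  _≐_ : Term L n → Term L n → Formula L n

¬' : ∀ {L n} → Formula L n → Formula L n
¬' φ = φ ⇒ ⊥'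

Sentence : Signature → Set
Sentence L = Formula L 0

module _ {L : Signature} where

  mutual
    subT : ∀ {n m} → (Fin n → Term L m) → Term L n → Term L m
    subT σ (var i)    = σ i
    subT σ (fun f ts) = fun f (subTs σ ts)

    subTs : ∀ {n m k} → (Fin n → Term L m) → Vec (Term L n) k → Vec (Term L m) k
    subTs σ []       = []
    subTs σ (t ∷ ts) = subT σ t ∷ subTs σ ts

  wkT : ∀ {n} → Term L n → Term L (suc n)
  wkT = subT (λ i → var (suc i))

  liftS : ∀ {n m} → (Fin n → Term L m) → Fin (suc n) → Term L (suc m)
  liftS σ zero    = var zero
  liftS σ (suc i) = wkT (σ i)

  subF : ∀ {n m} → (Fin n → Term L m) → Formula L n → Formula L m
  subF σ ⊥'        = ⊥'
  subF σ (φ ⇒ ψ)   = subF σ φ ⇒ subF σ ψ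
  subF σ (∀' φ)    = ∀' (subF (liftS σ) φ)
  subF σ (rel R ts) = rel R (subTs σ ts)
  subF σ (s ≐ t)   = subT σ s ≐ subT σ t

  wkF : ∀ {n} → Formula L n → Formula L (suc n)
  wkF = subF (λ i → var (suc i))

  _[_] : ∀ {n} → Formula L (suc n) → Term L n → Formula L n
  φ [ t ] = subF σ φ
    where
      σ : _ → _
      σ zero    = t
      σ (suc i) = var i

infix 3 _⊢_

data _⊢_ {L : Signature} : ∀ {n} → List (Formula L n) → Formula L n → Set where
  hyp      : ∀ {n} {Γ : List (Formula L n)} {φ} → φ ∈ Γ → Γ ⊢ φ
  ⇒I       : ∀ {n} {Γ : List (Formula L n)} {φ ψ} → (φ ∷ Γ) ⊢ ψ → Γ ⊢ φ ⇒ ψ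
  ⇒E       : ∀ {n} {Γ : List (Formula L n)} {φ ψ} → Γ ⊢ φ ⇒ ψ → Γ ⊢ φ → Γ ⊢ ψ
  raa      : ∀ {n} {Γ : List (Formula L n)} {φ} → (¬' φ ∷ Γ) ⊢ ⊥' → Γ ⊢ φ
  ∀I       : ∀ {n} {Γ : List (Formula L n)} {φ} → map wkF Γ ⊢ φ → Γ ⊢ ∀' φ
  ∀E       : ∀ {n} {Γ : List (Formula L n)} {φ} → Γ ⊢ ∀' φ → (t : Term L n) → Γ ⊢ φ [ t ]
  ≐refl    : ∀ {n} {Γ : List (Formula L n)} (t : Term L n) → Γ ⊢ t ≐ t
  ≐subst   : ∀ {n} {Γ : List (Formula L n)} {s t} (φ : Formula L (suc n)) →
             Γ ⊢ s ≐ t → Γ ⊢ φ [ s ] → Γ ⊢ φ [ t ]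
  nonempty : ∀ {n} {Γ : List (Formula L n)} {φ} → map wkF Γ ⊢ wkF φ → Γ ⊢ φ

-- Theories (given by their set of axioms) and their basic properties

Theory : Signature → Set₁
Theory L = Sentence L → Set

_⊩_ : ∀ {L} → Theory L → Sentence L → Set
_⊩_ {L} T φ = Σ (List (Sentence L)) λ Γ → All T Γ × (Γ ⊢ φ)

Consistent : ∀ {L} → Theory L → Set
Consistent T = ¬ (T ⊩ ⊥')

-- synthetic computability: algorithms are Agda functions
DecidablePred : ∀ {L} → (Sentence L → Set) → Set
DecidablePred {L} P = Σ (Sentence L → Bool) λ f →
  ∀ φ → (f φ ≡ true → P φ) × (P φ → f φ ≡ true)

SemiDecidablePred : ∀ {L} → (Sentence L → Set) → Set
SemiDecidablePred {L} P = Σ (Sentence L → ℕ → Bool) λ f →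
  ∀ φ → (P φ → ∃[ k ] f φ k ≡ true) × (∃[ k ] f φ k ≡ true → P φ)

RE : ∀ {L} → Theory L → Set
RE T = SemiDecidablePred T

DecidableTheory : ∀ {L} → Theory L → Set
DecidableTheory T = DecidablePred (T ⊩_)

Extends : ∀ {L} → Theory L → Theory L → Set
Extends U T = ∀ φ → T φ → U ⊩ φ

-- G1 in the form of essential undecidability
G1 : ∀ {L} → Theory L → Set₁
G1 {L} T = (U : Theory L) → RE U → Extends U T → Consistent U → ¬ DecidableTheory U

merge : ∀ {A B : Set} → (ℕ → Maybe A) → (ℕ → Maybe B) → ℕ → Maybe (A ⊎ B)
merge e₁ e₂ zero          = Maybe.map inj₁ (e₁ zero)
merge e₁ e₂ (suc zero)    = Maybe.map inj₂ (e₂ zero)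
merge e₁ e₂ (suc (suc n)) = merge (λ k → e₁ (suc k)) (λ k → e₂ (suc k)) n

merge-surj₁ : ∀ {A B : Set} (e₁ : ℕ → Maybe A) (e₂ : ℕ → Maybe B) k {a} →
              e₁ k ≡ just a → ∃[ n ] merge e₁ e₂ n ≡ just (inj₁ a)
merge-surj₁ e₁ e₂ zero eq = zero , cong (Maybe.map inj₁) eq
merge-surj₁ e₁ e₂ (suc k) eq with merge-surj₁ (λ k → e₁ (suc k)) (λ k → e₂ (suc k)) k eq
... | n , p = suc (suc n) , p

merge-surj₂ : ∀ {A B : Set} (e₁ : ℕ → Maybe A) (e₂ : ℕ → Maybe B) k {b} →
              e₂ k ≡ just b → ∃[ n ] merge e₁ e₂ n ≡ just (inj₂ b)
merge-surj₂ e₁ e₂ zero eq = suc zero , cong (Maybe.map inj₂) eq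
merge-surj₂ e₁ e₂ (suc k) eq with merge-surj₂ (λ k → e₁ (suc k)) (λ k → e₂ (suc k)) k eq
... | n , p = suc (suc n) , p

merge-surj : ∀ {A B : Set} (e₁ : ℕ → Maybe A) (e₂ : ℕ → Maybe B) →
             (∀ a → ∃[ n ] e₁ n ≡ just a) → (∀ b → ∃[ n ] e₂ n ≡ just b) →
             ∀ x → ∃[ n ] merge e₁ e₂ n ≡ just x
merge-surj e₁ e₂ s₁ s₂ (inj₁ a) with s₁ a
... | k , p = merge-surj₁ e₁ e₂ k p
merge-surj e₁ e₂ s₁ s₂ (inj₂ b) with s₂ b
... | k , p = merge-surj₂ e₁ e₂ k p

addPt : ∀ {A : Set} → (ℕ → Maybe A) → ℕ → Maybe (⊤ ⊎ A)
addPt e zero    = just (inj₁ tt)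
addPt e (suc n) = Maybe.map inj₂ (e n)

addPt-surj : ∀ {A : Set} (e : ℕ → Maybe A) → (∀ a → ∃[ n ] e n ≡ just a) →
             ∀ x → ∃[ n ] addPt e n ≡ just x
addPt-surj e s (inj₁ tt) = zero , refl
addPt-surj e s (inj₂ a) with s a
... | k , p = suc k , cong (Maybe.map inj₂) p

_⊕ˢ_ : Signature → Signature → Signature
L₁ ⊕ˢ L₂ = record
  { Fun           = Fun L₁ ⊎ Fun L₂
  ; Rel           = ⊤ ⊎ (Rel L₁ ⊎ Rel L₂)
  ; fun-arity     = [ fun-arity L₁ , fun-arity L₂ ]
  ; rel-arity     = [ (λ _ → 0) , [ rel-arity L₁ , rel-arity L₂ ] ]
  ; Fun-dec       = SumP.≡-dec (Fun-dec L₁) (Fun-dec L₂)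
  ; Rel-dec       = SumP.≡-dec UnitP._≟_ (SumP.≡-dec (Rel-dec L₁) (Rel-dec L₂))
  ; Fun-enum      = merge (Fun-enum L₁) (Fun-enum L₂)
  ; Fun-enum-surj = merge-surj (Fun-enum L₁) (Fun-enum L₂) (Fun-enum-surj L₁) (Fun-enum-surj L₂)
  ; Rel-enum      = addPt (merge (Rel-enum L₁) (Rel-enum L₂))
  ; Rel-enum-surj = addPt-surj (merge (Rel-enum L₁) (Rel-enum L₂))
                      (merge-surj (Rel-enum L₁) (Rel-enum L₂) (Rel-enum-surj L₁) (Rel-enum-surj L₂))
  }

module _ {L₁ L₂ : Signature} where

  P : Sentence (L₁ ⊕ˢ L₂)
  P = rel (inj₁ tt) []

  mutual
    inlT : ∀ {n} → Term L₁ n → Term (L₁ ⊕ˢ L₂) n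
    inlT (var i)    = var i
    inlT (fun f ts) = fun (inj₁ f) (inlTs ts)

    inlTs : ∀ {n k} → Vec (Term L₁ n) k → Vec (Term (L₁ ⊕ˢ L₂) n) k
    inlTs []       = []
    inlTs (t ∷ ts) = inlT t ∷ inlTs ts

  inlF : ∀ {n} → Formula L₁ n → Formula (L₁ ⊕ˢ L₂) n
  inlF ⊥'         = ⊥'
  inlF (φ ⇒ ψ)    = inlF φ ⇒ inlF ψ
  inlF (∀' φ)     = ∀' (inlF φ)
  inlF (rel R ts) = rel (inj₂ (inj₁ R)) (inlTs ts)
  inlF (s ≐ t)    = inlT s ≐ inlT t

  mutual
    inrT : ∀ {n} → Term L₂ n → Term (L₁ ⊕ˢ L₂) n
    inrT (var i)    = var i
    inrT (fun f ts) = fun (inj₂ f) (inrTs ts)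

    inrTs : ∀ {n k} → Vec (Term L₂ n) k → Vec (Term (L₁ ⊕ˢ L₂) n) k
    inrTs []       = []
    inrTs (t ∷ ts) = inrT t ∷ inrTs ts

  inrF : ∀ {n} → Formula L₂ n → Formula (L₁ ⊕ˢ L₂) n
  inrF ⊥'         = ⊥'
  inrF (φ ⇒ ψ)    = inrF φ ⇒ inrF ψ
  inrF (∀' φ)     = ∀' (inrF φ)
  inrF (rel R ts) = rel (inj₂ (inj₂ R)) (inrTs ts)
  inrF (s ≐ t)    = inrT s ≐ inrT t

_⊕_ : ∀ {L₁ L₂} → Theory L₁ → Theory L₂ → Theory (L₁ ⊕ˢ L₂)
_⊕_ {L₁} {L₂} A B χ =
    (∃[ φ ] (A ⊩ φ) × (χ ≡ (P {L₁} {L₂} ⇒ inlF φ)))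
  ⊎ (∃[ ψ ] (B ⊩ ψ) × (χ ≡ (¬' (P {L₁} {L₂}) ⇒ inrF ψ)))

-- Let U be a consistent decidable extension of A ⊕ B. If U does not prove ¬P,
-- the L₁-theory {φ | U ⊢ P → φ} is a consistent extension of A; if U proves
-- ¬P, the L₂-theory {ψ | U ⊢ ¬P → ψ} is a consistent extension of B (as U is
-- consistent). Derivations over L₁ and L₂ translate into derivations over the
-- merged signature, so these theories are deductively closed, hence decidable
-- (and r.e.) because U is, contradicting G1 for A or for B.
module Submission where

open import Defs
open import Function using (_∘_; case_of_)
open import Data.Nat using (zero; suc)
open import Data.Fin using (Fin; zero; suc)
open import Data.Vec using (Vec; []; _∷_)
open import Data.List using (List; []; _∷_; map; _++_)
open import Data.List.Properties using (map-∘; map-cong)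
open import Data.List.Membership.Propositional.Properties using (∈-map⁺)
open import Data.List.Relation.Binary.Subset.Propositional using (_⊆_)
import Data.List.Relation.Binary.Subset.Propositional.Properties as ⊆
open import Data.List.Relation.Unary.All as All using (All; []; _∷_)
import Data.List.Relation.Unary.All.Properties as All
open import Data.List.Relation.Unary.Any using (here; there)
open import Data.Bool using (true; false)
open import Data.Product using (_,_; proj₁; proj₂)
open import Data.Sum using (inj₁; inj₂)
open import Relation.Nullary using (¬_; Dec; yes; no)
open import Relation.Binary.PropositionalEquality
  using (_≡_; _≗_; refl; cong; cong₂; sym; trans; subst; subst₂)

record SignatureMorphism (L L' : Signature) : Set where
  field
    onFun       : Fun L → Fun L'
    onRel       : Rel L → Rel L'
    onFun-arity : ∀ f → fun-arity L f ≡ fun-arity L' (onFun f)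
    onRel-arity : ∀ R → rel-arity L R ≡ rel-arity L' (onRel R)

subTs-subst : ∀ {L n m k k'} (σ : Fin n → Term L m) (eq : k ≡ k') (ts : Vec (Term L n) k) →
              subTs σ (subst (Vec (Term L n)) eq ts) ≡ subst (Vec (Term L m)) eq (subTs σ ts)
subTs-subst σ refl ts = refl

module _ {L L' : Signature} (ι : SignatureMorphism L L') where
  open SignatureMorphism ι

  mutual
    mapT : ∀ {n} → Term L n → Term L' n
    mapT (var i)    = var i
    mapT (fun f ts) = fun (onFun f) (subst (Vec (Term L' _)) (onFun-arity f) (mapTs ts))

    mapTs : ∀ {n k} → Vec (Term L n) k → Vec (Term L' n) k
    mapTs []       = []
    mapTs (t ∷ ts) = mapT t ∷ mapTs ts

  mapF : ∀ {n} → Formula L n → Formula L' n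
  mapF ⊥'         = ⊥'
  mapF (φ ⇒ ψ)    = mapF φ ⇒ mapF ψ
  mapF (∀' φ)     = ∀' (mapF φ)
  mapF (rel R ts) = rel (onRel R) (subst (Vec (Term L' _)) (onRel-arity R) (mapTs ts))
  mapF (s ≐ t)    = mapT s ≐ mapT t

  mutual
    mapT-subT : ∀ {n m} {σ : Fin n → Term L m} {σ' : Fin n → Term L' m} →
                (∀ i → mapT (σ i) ≡ σ' i) → ∀ t → mapT (subT σ t) ≡ subT σ' (mapT t)
    mapT-subT h (var i)    = h i
    mapT-subT {σ' = σ'} h (fun f ts) = cong (fun (onFun f)) (trans
      (cong (subst _ (onFun-arity f)) (mapTs-subTs h ts))
      (sym (subTs-subst σ' (onFun-arity f) (mapTs ts))))

    mapTs-subTs : ∀ {n m k} {σ : Fin n → Term L m} {σ' : Fin n → Term L' m} →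
                  (∀ i → mapT (σ i) ≡ σ' i) →
                  (ts : Vec (Term L n) k) → mapTs (subTs σ ts) ≡ subTs σ' (mapTs ts)
    mapTs-subTs h []       = refl
    mapTs-subTs h (t ∷ ts) = cong₂ _∷_ (mapT-subT h t) (mapTs-subTs h ts)

  mapT-liftS : ∀ {n m} {σ : Fin n → Term L m} {σ' : Fin n → Term L' m} →
               (∀ i → mapT (σ i) ≡ σ' i) → ∀ i → mapT (liftS σ i) ≡ liftS σ' i
  mapT-liftS h zero    = refl
  mapT-liftS {σ = σ} h (suc i) = trans (mapT-subT (λ _ → refl) (σ i)) (cong wkT (h i))

  mapF-subF : ∀ {n m} {σ : Fin n → Term L m} {σ' : Fin n → Term L' m} →
              (∀ i → mapT (σ i) ≡ σ' i) → ∀ φ → mapF (subF σ φ) ≡ subF σ' (mapF φ)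
  mapF-subF h ⊥'         = refl
  mapF-subF h (φ ⇒ ψ)    = cong₂ _⇒_ (mapF-subF h φ) (mapF-subF h ψ)
  mapF-subF h (∀' φ)     = cong ∀' (mapF-subF (mapT-liftS h) φ)
  mapF-subF {σ' = σ'} h (rel R ts) = cong (rel (onRel R)) (trans
    (cong (subst _ (onRel-arity R)) (mapTs-subTs h ts))
    (sym (subTs-subst σ' (onRel-arity R) (mapTs ts))))
  mapF-subF h (s ≐ t)    = cong₂ _≐_ (mapT-subT h s) (mapT-subT h t)

  mapF-wkF : ∀ {n} (φ : Formula L n) → mapF (wkF φ) ≡ wkF (mapF φ)
  mapF-wkF = mapF-subF (λ _ → refl)

  map-mapF-wkF : ∀ {n} (Γ : List (Formula L n)) → map mapF (map wkF Γ) ≡ map wkF (map mapF Γ)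
  map-mapF-wkF Γ = trans (sym (map-∘ Γ)) (trans (map-cong mapF-wkF Γ) (map-∘ Γ))

  mapF-[] : ∀ {n} (φ : Formula L (suc n)) t → mapF (φ [ t ]) ≡ mapF φ [ mapT t ]
  mapF-[] φ t = mapF-subF (λ { zero → refl ; (suc i) → refl }) φ

  map-⊢ : ∀ {n} {Γ : List (Formula L n)} {φ} → Γ ⊢ φ → map mapF Γ ⊢ mapF φ
  map-⊢ (hyp p)      = hyp (∈-map⁺ mapF p)
  map-⊢ (⇒I d)       = ⇒I (map-⊢ d)
  map-⊢ (⇒E d e)     = ⇒E (map-⊢ d) (map-⊢ e)
  map-⊢ (raa d)      = raa (map-⊢ d)
  map-⊢ {Γ = Γ} (∀I d) = ∀I (subst (_⊢ _) (map-mapF-wkF Γ) (map-⊢ d))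
  map-⊢ (∀E {φ = φ} d t) = subst (_ ⊢_) (sym (mapF-[] φ t)) (∀E (map-⊢ d) (mapT t))
  map-⊢ (≐refl t)    = ≐refl (mapT t)
  map-⊢ (≐subst {s = s} {t = t} φ d e) = subst (_ ⊢_) (sym (mapF-[] φ t))
    (≐subst (mapF φ) (map-⊢ d) (subst (_ ⊢_) (mapF-[] φ s) (map-⊢ e)))
  map-⊢ {Γ = Γ} (nonempty {φ = φ} d) =
    nonempty (subst₂ _⊢_ (map-mapF-wkF Γ) (mapF-wkF φ) (map-⊢ d))

-- The arity proofs of the two injections are refl, so mapF agrees with inlF and
-- inrF clause by clause.
module _ {L₁ L₂ : Signature} where

  inlMorphism : SignatureMorphism L₁ (L₁ ⊕ˢ L₂)
  inlMorphism = record
    { onFun = inj₁ ; onRel = inj₂ ∘ inj₁ ; onFun-arity = λ _ → refl ; onRel-arity = λ _ → refl }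

  inrMorphism : SignatureMorphism L₂ (L₁ ⊕ˢ L₂)
  inrMorphism = record
    { onFun = inj₂ ; onRel = inj₂ ∘ inj₂ ; onFun-arity = λ _ → refl ; onRel-arity = λ _ → refl }

  mutual
    inlT≗mapT : ∀ {n} → inlT {L₁} {L₂} {n} ≗ mapT inlMorphism
    inlT≗mapT (var i)    = refl
    inlT≗mapT (fun f ts) = cong (fun (inj₁ f)) (inlTs≗mapTs ts)

    inlTs≗mapTs : ∀ {n k} → inlTs {L₁} {L₂} {n} {k} ≗ mapTs inlMorphism
    inlTs≗mapTs []       = refl
    inlTs≗mapTs (t ∷ ts) = cong₂ _∷_ (inlT≗mapT t) (inlTs≗mapTs ts)

  inlF≗mapF : ∀ {n} → inlF {L₁} {L₂} {n} ≗ mapF inlMorphism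
  inlF≗mapF ⊥'         = refl
  inlF≗mapF (φ ⇒ ψ)    = cong₂ _⇒_ (inlF≗mapF φ) (inlF≗mapF ψ)
  inlF≗mapF (∀' φ)     = cong ∀' (inlF≗mapF φ)
  inlF≗mapF (rel R ts) = cong (rel (inj₂ (inj₁ R))) (inlTs≗mapTs ts)
  inlF≗mapF (s ≐ t)    = cong₂ _≐_ (inlT≗mapT s) (inlT≗mapT t)

  mutual
    inrT≗mapT : ∀ {n} → inrT {L₁} {L₂} {n} ≗ mapT inrMorphism
    inrT≗mapT (var i)    = refl
    inrT≗mapT (fun f ts) = cong (fun (inj₂ f)) (inrTs≗mapTs ts)

    inrTs≗mapTs : ∀ {n k} → inrTs {L₁} {L₂} {n} {k} ≗ mapTs inrMorphism
    inrTs≗mapTs []       = refl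
    inrTs≗mapTs (t ∷ ts) = cong₂ _∷_ (inrT≗mapT t) (inrTs≗mapTs ts)

  inrF≗mapF : ∀ {n} → inrF {L₁} {L₂} {n} ≗ mapF inrMorphism
  inrF≗mapF ⊥'         = refl
  inrF≗mapF (φ ⇒ ψ)    = cong₂ _⇒_ (inrF≗mapF φ) (inrF≗mapF ψ)
  inrF≗mapF (∀' φ)     = cong ∀' (inrF≗mapF φ)
  inrF≗mapF (rel R ts) = cong (rel (inj₂ (inj₂ R))) (inrTs≗mapTs ts)
  inrF≗mapF (s ≐ t)    = cong₂ _≐_ (inrT≗mapT s) (inrT≗mapT t)

  inl-⊢ : ∀ {n} {Γ : List (Formula L₁ n)} {φ} → Γ ⊢ φ → map (inlF {L₁} {L₂}) Γ ⊢ inlF φ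
  inl-⊢ {Γ = Γ} {φ} d =
    subst₂ _⊢_ (sym (map-cong inlF≗mapF Γ)) (sym (inlF≗mapF φ)) (map-⊢ inlMorphism d)

  inr-⊢ : ∀ {n} {Γ : List (Formula L₂ n)} {φ} → Γ ⊢ φ → map (inrF {L₁} {L₂}) Γ ⊢ inrF φ
  inr-⊢ {Γ = Γ} {φ} d =
    subst₂ _⊢_ (sym (map-cong inrF≗mapF Γ)) (sym (inrF≗mapF φ)) (map-⊢ inrMorphism d)

module _ {L : Signature} where

  ⊢-weaken : ∀ {n} {Γ Δ : List (Formula L n)} {φ} → Γ ⊆ Δ → Γ ⊢ φ → Δ ⊢ φ
  ⊢-weaken Γ⊆Δ (hyp p)        = hyp (Γ⊆Δ p)
  ⊢-weaken Γ⊆Δ (⇒I d)         = ⇒I (⊢-weaken (⊆.∷⁺ʳ _ Γ⊆Δ) d)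
  ⊢-weaken Γ⊆Δ (⇒E d e)       = ⇒E (⊢-weaken Γ⊆Δ d) (⊢-weaken Γ⊆Δ e)
  ⊢-weaken Γ⊆Δ (raa d)        = raa (⊢-weaken (⊆.∷⁺ʳ _ Γ⊆Δ) d)
  ⊢-weaken Γ⊆Δ (∀I d)         = ∀I (⊢-weaken (⊆.map⁺ wkF Γ⊆Δ) d)
  ⊢-weaken Γ⊆Δ (∀E d t)       = ∀E (⊢-weaken Γ⊆Δ d) t
  ⊢-weaken Γ⊆Δ (≐refl t)      = ≐refl t
  ⊢-weaken Γ⊆Δ (≐subst φ d e) = ≐subst φ (⊢-weaken Γ⊆Δ d) (⊢-weaken Γ⊆Δ e)
  ⊢-weaken Γ⊆Δ (nonempty d)   = nonempty (⊢-weaken (⊆.map⁺ wkF Γ⊆Δ) d)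

  ⊢-cut : ∀ {n} {Γ Δ : List (Formula L n)} {ψ} → All (Δ ⊢_) Γ → Γ ⊢ ψ → Δ ⊢ ψ
  ⊢-cut []       d = ⊢-weaken (λ ()) d
  ⊢-cut (e ∷ es) d = ⇒E (⊢-cut es (⇒I d)) e

  ⊢-relativize : ∀ {n} {Γ : List (Formula L n)} {Q ψ} → Γ ⊢ ψ → map (Q ⇒_) Γ ⊢ Q ⇒ ψ
  ⊢-relativize {Q = Q} d = ⇒I (⊢-cut (All.tabulate λ γ∈Γ →
    ⇒E (hyp (there (∈-map⁺ (Q ⇒_) γ∈Γ))) (hyp (here refl))) d)

  ⊩-axiom : ∀ {T : Theory L} {φ} → T φ → T ⊩ φ
  ⊩-axiom Tφ = _ , Tφ ∷ [] , hyp (here refl)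

  ⊩-cut : ∀ {T : Theory L} {Δ ψ} → All (T ⊩_) Δ → Δ ⊢ ψ → T ⊩ ψ
  ⊩-cut []                    d = [] , [] , d
  ⊩-cut ((Γ₂ , T-Γ₂ , d₂) ∷ ps) d =
    let Γ₁ , T-Γ₁ , d₁ = ⊩-cut ps (⇒I d) in
    Γ₁ ++ Γ₂ , All.++⁺ T-Γ₁ T-Γ₂ ,
    ⇒E (⊢-weaken (⊆.xs⊆xs++ys Γ₁ Γ₂) d₁) (⊢-weaken (⊆.xs⊆ys++xs Γ₂ Γ₁) d₂)

  ⊩-mp : ∀ {T : Theory L} {φ ψ} → T ⊩ (φ ⇒ ψ) → T ⊩ φ → T ⊩ ψ
  ⊩-mp p q = ⊩-cut (p ∷ q ∷ []) (⇒E (hyp (here refl)) (hyp (there (here refl))))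

module _ {L : Signature} {X : Sentence L → Set} where

  DecidablePred⇒Dec : DecidablePred X → ∀ φ → Dec (X φ)
  DecidablePred⇒Dec (f , spec) φ with f φ in eq
  ... | true  = yes (proj₁ (spec φ) eq)
  ... | false = no λ p → case trans (sym eq) (proj₂ (spec φ) p) of λ ()

  DecidablePred⇒SemiDecidablePred : DecidablePred X → SemiDecidablePred X
  DecidablePred⇒SemiDecidablePred (f , spec) =
    (λ φ _ → f φ) , λ φ → (λ p → zero , proj₂ (spec φ) p) , λ (_ , e) → proj₁ (spec φ) e

  DecidablePred-resp : ∀ {Y : Sentence L → Set} → (∀ {φ} → X φ → Y φ) → (∀ {φ} → Y φ → X φ) →
                       DecidablePred X → DecidablePred Y
  DecidablePred-resp X⇒Y Y⇒X (f , spec) = f , λ φ → X⇒Y ∘ proj₁ (spec φ) , proj₂ (spec φ) ∘ Y⇒X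

DecidablePred-∘ : ∀ {L L'} {P : Sentence L' → Set} (g : Sentence L → Sentence L') →
                  DecidablePred P → DecidablePred (P ∘ g)
DecidablePred-∘ g (f , spec) = f ∘ g , spec ∘ g

module Relativization {L₀ L : Signature}
  (tr : ∀ {n} → Formula L₀ n → Formula L n)
  (tr-⊢ : ∀ {n} {Γ : List (Formula L₀ n)} {φ} → Γ ⊢ φ → map tr Γ ⊢ tr φ)
  (U : Theory L) (Q : Sentence L) where

  Relativized : Theory L₀
  Relativized φ = U ⊩ (Q ⇒ tr φ)

  Relativized-closed : ∀ {φ} → Relativized ⊩ φ → Relativized φ
  Relativized-closed (_ , axioms , d) =
    ⊩-cut (All.map⁺ (All.map⁺ axioms)) (⊢-relativize (tr-⊢ d))

  interprets-G1⇒undecidable : ∀ {T : Theory L₀} → G1 T → (∀ φ → T φ → Relativized φ) →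
                              ¬ Relativized ⊥' → ¬ DecidableTheory U
  interprets-G1⇒undecidable G1-T interprets consistent decU =
    G1-T Relativized (DecidablePred⇒SemiDecidablePred decR) (λ φ → ⊩-axiom ∘ interprets φ)
      (consistent ∘ Relativized-closed) (DecidablePred-resp ⊩-axiom Relativized-closed decR)
    where
      decR : DecidablePred Relativized
      decR = DecidablePred-∘ (λ φ → Q ⇒ tr φ) decU

lemma4p14 : ∀ {L₁ L₂ : Signature} (A : Theory L₁) (B : Theory L₂) →
    RE A → RE B → G1 A → G1 B → G1 (A ⊕ B)
lemma4p14 {L₁} {L₂} A B _ _ G1-A G1-B U _ extU conU decU
  with DecidablePred⇒Dec decU (¬' (P {L₁} {L₂}))
... | no U⊬¬P = Relativization.interprets-G1⇒undecidable inlF inl-⊢ U P G1-A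
  (λ φ Aφ → extU _ (inj₁ (φ , ⊩-axiom Aφ , refl))) U⊬¬P decU
... | yes U⊢¬P = Relativization.interprets-G1⇒undecidable inrF inr-⊢ U (¬' P) G1-B
  (λ ψ Bψ → extU _ (inj₂ (ψ , ⊩-axiom Bψ , refl))) (λ U⊢¬¬P → conU (⊩-mp U⊢¬¬P U⊢¬P)) decU
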